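{- Consider two-player nim with $k\ge1$ piles of initial sizes $s_1,\dots,s_k\ge1$, played either under misère play (the player removing the last token loses) or normal play (the player removing the last token wins). On each turn, if the current nonempty pile sizes are $t_1,\dots,t_m$, the legal moves are "remove $r$ tokens from pile $j$" for $1\le r\le t_j$, and the player to move chooses one of these $t_1+\dots+t_m$ moves uniformly at random, independently of all previous choices. Then: (a) the expected number of moves played is $\sum_{i=1}^k\sum_{r=1}^{s_i}\frac1r=\sum_{i=1}^k H_{s_i}$, where $H_t=\sum_{r=1}^t\frac1r$; (b) if every pile has size $1$, the game lasts exactly $k$ turns, and the winner depends only on whether $k$ is even or odd; (c) otherwise, if at least one pile has size greater than $1$, each player wins with probability $1/2$. -}

module Defs where

open import Data.Nat as ℕ using (ℕ; zero; suc; _∸_)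
open import Data.Integer using (+_)
open import Data.Rational using (ℚ; _/_; 0ℚ; 1ℚ; _+_; _*_; _-_)
open import Data.List using (List; []; _∷_; map; length; _++_; foldr)
open import Data.List.Membership.Propositional using (_∈_)
open import Relation.Binary.PropositionalEquality using (_≡_)

-- A position is the list of pile sizes (empty piles may remain as 0's;
-- they contribute no moves).
Position : Set
Position = List ℕ

removals : ℕ → List ℕ
removals zero    = []
removals (suc t) = t ∷ removals t   -- r = 1 gives t, ..., r = t+1 gives 0

-- The list of legal moves from a position, one entry per move
-- "remove r tokens from pile j" (1 ≤ r ≤ t_j), given as the resulting position.
-- Its length is t_1 + ... + t_m.
moves : Position → List Position
moves []      = []
moves (t ∷ s) = map (_∷ s) (removals t) ++ map (t ∷_) (moves s)

-- Total number of tokens; each move removes at least one, so the game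
-- ends after at most this many moves.
tokens : Position → ℕ
tokens = foldr ℕ._+_ 0

sumℚ : List ℚ → ℚ
sumℚ = foldr _+_ 0ℚ

-- Uniform average over a (nonempty) list; 0 on the empty list.
avg : List ℚ → ℚ
avg []       = 0ℚ
avg (x ∷ xs) = sumℚ (x ∷ xs) * (+ 1 / suc (length xs))

-- Expected number of remaining moves under uniformly random play,
-- computed with a fuel parameter (fuel ≥ tokens s suffices).
expMovesF : ℕ → Position → ℚ
expMovesF zero    s = 0ℚ
expMovesF (suc f) s with moves s
... | []       = 0ℚ
... | (m ∷ ms) = 1ℚ + avg (map (expMovesF f) (m ∷ ms))

expectedMoves : Position → ℚ
expectedMoves s = expMovesF (tokens s) s

data Convention : Set where
  normal misere : Convention

-- Probability that the player to move at a terminal position (no tokens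
-- left, i.e. the opponent removed the last token) wins.
terminalWin : Convention → ℚ
terminalWin normal = 0ℚ
terminalWin misere = 1ℚ

winProbF : Convention → ℕ → Position → ℚ
winProbF c zero    s = terminalWin c
winProbF c (suc f) s with moves s
... | []       = terminalWin c
... | (m ∷ ms) = avg (map (λ s′ → 1ℚ - winProbF c f s′) (m ∷ ms))

firstPlayerWins : Convention → Position → ℚ
firstPlayerWins c s = winProbF c (tokens s) s

H : ℕ → ℚ
H zero    = 0ℚ
H (suc t) = H t + (+ 1 / suc t)

data Play : Position → ℕ → Set where
  done : ∀ {s} → moves s ≡ [] → Play s 0
  step : ∀ {s s′ n} → s′ ∈ moves s → Play s′ n → Play s (suc n)

{-# OPTIONS --safe #-}
module Submission where

-- Both quantities are determined by a one-step recurrence over the t₁ + ⋯ + t_m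
-- equally likely moves (the fuel never runs out, since every move removes a
-- token), so it suffices to exhibit closed forms satisfying the recurrences.
-- For the length of the game this is Σᵢ H_{sᵢ}, by the identity
-- Σ_{u<t} H_u = t (H_t − 1).  For the winner it is a quantity depending only on
-- whether some pile has at least two tokens and, if not, on the parity of the
-- number of 1-piles.  From a position with a pile of size ≥ 2, the two moves
-- reducing such a pile to 0 and to 1 give complementary winning probabilities,
-- and every other move leaves a pile of size ≥ 2, so the average is ½.

open import Defs
open import Data.Bool using (Bool; true; false; not; _xor_; if_then_else_)
open import Data.Bool.Properties using (xor-assoc; xor-comm)
open import Data.Integer as ℤ using (+_)
import Data.Integer.Tactic.RingSolver as ℤ-RingSolver
open import Data.List using (List; []; _∷_; map; length; _++_)
open import Data.List.Properties using (map-++; map-∘; map-cong; map-cong-local; length-map; length-++)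
open import Data.List.Membership.Propositional using (_∈_)
open import Data.List.Membership.Propositional.Properties using (∈-++⁻; ∈-map⁻)
open import Data.List.Relation.Unary.All as All using (All; []; _∷_)
open import Data.List.Relation.Unary.Any using (Any; here; there)
open import Data.Nat as ℕ using (ℕ; zero; suc; _≤_; _<_; _%_; _≡ᵇ_; z≤n; s≤s)
open import Data.Nat.Properties using (≤-refl; ≤-pred; m<n⇒m<1+n; <-≤-trans; n≤0⇒n≡0; +-suc; +-monoˡ-<; +-monoʳ-<)
open import Data.Product using (_×_; _,_)
open import Data.Rational using (ℚ; _/_; 0ℚ; 1ℚ; _+_; _*_; _-_; toℚᵘ)
open import Data.Rational.Properties
  using (_≟_; +-assoc; +-identityˡ; +-identityʳ; *-identityˡ; *-zeroˡ; *-distribʳ-+; +-*-commutativeRing;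
         toℚᵘ-injective; toℚᵘ-fromℚᵘ; toℚᵘ-homo-+; toℚᵘ-homo-*)
import Data.Rational.Unnormalised as ℚᵘ
import Data.Rational.Unnormalised.Properties as ℚᵘ
open import Data.Sum using (inj₁; inj₂)
open import Function using (_∘_)
open import Level using (0ℓ)
open import Relation.Binary.PropositionalEquality
open import Relation.Nullary.Decidable using (dec⇒maybe)
open import Tactic.RingSolver using (solve-∀)
open import Tactic.RingSolver.Core.AlmostCommutativeRing using (AlmostCommutativeRing; fromCommutativeRing)

ℚ-ring : AlmostCommutativeRing 0ℓ 0ℓ
ℚ-ring = fromCommutativeRing +-*-commutativeRing (λ x → dec⇒maybe (0ℚ ≟ x))

fromℕ : ℕ → ℚ
fromℕ n = + n / 1

fromℕ-suc : ∀ n → fromℕ (suc n) ≡ 1ℚ + fromℕ n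
fromℕ-suc n = toℚᵘ-injective (begin
  toℚᵘ (fromℕ (suc n))         ≈⟨ toℚᵘ-fromℚᵘ (ℚᵘ.mkℚᵘ (+ suc n) 0) ⟩
  ℚᵘ.mkℚᵘ (+ suc n) 0          ≈⟨ ℚᵘ.*≡* (cross-multiplied (+ n)) ⟩
  ℚᵘ.1ℚᵘ ℚᵘ.+ ℚᵘ.mkℚᵘ (+ n) 0  ≈⟨ ℚᵘ.+-congʳ ℚᵘ.1ℚᵘ (toℚᵘ-fromℚᵘ (ℚᵘ.mkℚᵘ (+ n) 0)) ⟨
  ℚᵘ.1ℚᵘ ℚᵘ.+ toℚᵘ (fromℕ n)   ≈⟨ toℚᵘ-homo-+ 1ℚ (fromℕ n) ⟨
  toℚᵘ (1ℚ + fromℕ n)          ∎)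
  where
  open ℚᵘ.≃-Reasoning
  cross-multiplied : ∀ x → (+ 1 ℤ.+ x) ℤ.* + 1 ≡ (+ 1 ℤ.* + 1 ℤ.+ x ℤ.* + 1) ℤ.* + 1
  cross-multiplied = ℤ-RingSolver.solve-∀

fromℕ-+ : ∀ m n → fromℕ (m ℕ.+ n) ≡ fromℕ m + fromℕ n
fromℕ-+ zero    n = sym (+-identityˡ (fromℕ n))
fromℕ-+ (suc m) n = begin
  fromℕ (suc (m ℕ.+ n))       ≡⟨ fromℕ-suc (m ℕ.+ n) ⟩
  1ℚ + fromℕ (m ℕ.+ n)        ≡⟨ cong (λ x → 1ℚ + x) (fromℕ-+ m n) ⟩
  1ℚ + (fromℕ m + fromℕ n)    ≡⟨ +-assoc 1ℚ (fromℕ m) (fromℕ n) ⟨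
  (1ℚ + fromℕ m) + fromℕ n    ≡⟨ cong (_+ fromℕ n) (fromℕ-suc m) ⟨
  fromℕ (suc m) + fromℕ n     ∎
  where open ≡-Reasoning

fromℕ-suc-* : ∀ n x → fromℕ (suc n) * x ≡ x + fromℕ n * x
fromℕ-suc-* n x = begin
  fromℕ (suc n) * x      ≡⟨ cong (_* x) (fromℕ-suc n) ⟩
  (1ℚ + fromℕ n) * x     ≡⟨ *-distribʳ-+ x 1ℚ (fromℕ n) ⟩
  1ℚ * x + fromℕ n * x   ≡⟨ cong (_+ fromℕ n * x) (*-identityˡ x) ⟩
  x + fromℕ n * x        ∎
  where open ≡-Reasoning

fromℕ-suc-*-inverse : ∀ n → fromℕ (suc n) * (+ 1 / suc n) ≡ 1ℚ
fromℕ-suc-*-inverse n = toℚᵘ-injective (begin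
  toℚᵘ (fromℕ (suc n) * (+ 1 / suc n))
    ≈⟨ toℚᵘ-homo-* (fromℕ (suc n)) (+ 1 / suc n) ⟩
  toℚᵘ (fromℕ (suc n)) ℚᵘ.* toℚᵘ (+ 1 / suc n)
    ≈⟨ ℚᵘ.*-cong (toℚᵘ-fromℚᵘ (ℚᵘ.mkℚᵘ (+ suc n) 0)) (toℚᵘ-fromℚᵘ (ℚᵘ.mkℚᵘ (+ 1) n)) ⟩
  ℚᵘ.mkℚᵘ (+ suc n) 0 ℚᵘ.* ℚᵘ.mkℚᵘ (+ 1) n
    ≈⟨ ℚᵘ.*-inverseʳ (ℚᵘ.mkℚᵘ (+ suc n) 0) ⟩
  ℚᵘ.1ℚᵘ
    ∎)
  where open ℚᵘ.≃-Reasoning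

sumℚ-++ : ∀ xs ys → sumℚ (xs ++ ys) ≡ sumℚ xs + sumℚ ys
sumℚ-++ []       ys = sym (+-identityˡ (sumℚ ys))
sumℚ-++ (x ∷ xs) ys = trans (cong (λ y → x + y) (sumℚ-++ xs ys)) (sym (+-assoc x (sumℚ xs) (sumℚ ys)))

sumℚ-map-+ : ∀ {A : Set} (f g : A → ℚ) xs →
             sumℚ (map (λ x → f x + g x) xs) ≡ sumℚ (map f xs) + sumℚ (map g xs)
sumℚ-map-+ f g []       = refl
sumℚ-map-+ f g (x ∷ xs) = trans (cong (λ y → f x + g x + y) (sumℚ-map-+ f g xs))
                                (interchange (f x) (g x) (sumℚ (map f xs)) (sumℚ (map g xs)))
  where
  interchange : ∀ a b c d → (a + b) + (c + d) ≡ (a + c) + (b + d)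
  interchange = solve-∀ ℚ-ring

sumℚ-map-const : ∀ {A : Set} (c : ℚ) (xs : List A) → sumℚ (map (λ _ → c) xs) ≡ fromℕ (length xs) * c
sumℚ-map-const c []       = sym (*-zeroˡ c)
sumℚ-map-const c (x ∷ xs) = trans (cong (λ y → c + y) (sumℚ-map-const c xs)) (sym (fromℕ-suc-* (length xs) c))

avg-∷ : ∀ x xs {v} → sumℚ (x ∷ xs) ≡ fromℕ (length (x ∷ xs)) * v → avg (x ∷ xs) ≡ v
avg-∷ x xs {v} sum≡ = begin
  sumℚ (x ∷ xs) * r  ≡⟨ cong (_* r) sum≡ ⟩
  n * v * r          ≡⟨ *-right-comm n v r ⟩
  n * r * v          ≡⟨ cong (_* v) (fromℕ-suc-*-inverse (length xs)) ⟩
  1ℚ * v             ≡⟨ *-identityˡ v ⟩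
  v                  ∎
  where
  open ≡-Reasoning
  n = fromℕ (suc (length xs))
  r = + 1 / suc (length xs)
  *-right-comm : ∀ a b c → a * b * c ≡ a * c * b
  *-right-comm = solve-∀ ℚ-ring

length-removals : ∀ t → length (removals t) ≡ t
length-removals zero    = refl
length-removals (suc t) = cong suc (length-removals t)

length-moves : ∀ s → length (moves s) ≡ tokens s
length-moves []      = refl
length-moves (t ∷ s) = begin
  length (map (_∷ s) (removals t) ++ map (t ∷_) (moves s))
    ≡⟨ length-++ (map (_∷ s) (removals t)) ⟩
  length (map (_∷ s) (removals t)) ℕ.+ length (map (t ∷_) (moves s))
    ≡⟨ cong₂ ℕ._+_ (length-map (_∷ s) (removals t)) (length-map (t ∷_) (moves s)) ⟩
  length (removals t) ℕ.+ length (moves s)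
    ≡⟨ cong₂ ℕ._+_ (length-removals t) (length-moves s) ⟩
  t ℕ.+ tokens s
    ∎
  where open ≡-Reasoning

moves≡[]⇒tokens≡0 : ∀ s → moves s ≡ [] → tokens s ≡ 0
moves≡[]⇒tokens≡0 s no-moves = trans (sym (length-moves s)) (cong length no-moves)

data Move : Position → Position → Set where
  remove : ∀ {t u s} → u < t → Move (t ∷ s) (u ∷ s)
  later  : ∀ {t s m} → Move s m → Move (t ∷ s) (t ∷ m)

∈-removals⇒< : ∀ {u} t → u ∈ removals t → u < t
∈-removals⇒< (suc t) (here refl) = ≤-refl
∈-removals⇒< (suc t) (there u∈) = m<n⇒m<1+n (∈-removals⇒< t u∈)

∈-moves⇒Move : ∀ {m} s → m ∈ moves s → Move s m
∈-moves⇒Move (t ∷ s) m∈ with ∈-++⁻ (map (_∷ s) (removals t)) m∈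
... | inj₁ m∈removals with ∈-map⁻ (_∷ s) m∈removals
...   | u , u∈ , refl = remove (∈-removals⇒< t u∈)
∈-moves⇒Move (t ∷ s) m∈ | inj₂ m∈later with ∈-map⁻ (t ∷_) m∈later
...   | m , m∈ , refl = later (∈-moves⇒Move s m∈)

Move⇒tokens-< : ∀ {s m} → Move s m → tokens m < tokens s
Move⇒tokens-< (remove {s = s} u<t) = +-monoˡ-< (tokens s) u<t
Move⇒tokens-< (later {t} mv)       = +-monoʳ-< t (Move⇒tokens-< mv)

Move-≤1 : ∀ {s m} → Move s m → All (_≤ 1) s → All (_≤ 1) m × tokens s ≡ suc (tokens m)
Move-≤1 (remove (s≤s z≤n)) (s≤s z≤n ∷ ≤1s) = z≤n ∷ ≤1s , refl
Move-≤1 (later {t} mv)     (t≤1 ∷ ≤1s) with Move-≤1 mv ≤1s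
... | ≤1m , tokens≡ = t≤1 ∷ ≤1m , trans (cong (t ℕ.+_) tokens≡) (+-suc t _)

moves-within-fuel : ∀ s {f m ms x} → moves s ≡ m ∷ ms → tokens s ≤ suc f → x ∈ m ∷ ms → tokens x ≤ f
moves-within-fuel s {x = x} eq tokens≤ x∈ =
  ≤-pred (<-≤-trans (Move⇒tokens-< (∈-moves⇒Move s (subst (x ∈_) (sym eq) x∈))) tokens≤)

sumℚ-moves-∷ : ∀ (φ : Position → ℚ) t s →
  sumℚ (map φ (moves (t ∷ s))) ≡
  sumℚ (map (λ u → φ (u ∷ s)) (removals t)) + sumℚ (map (λ m → φ (t ∷ m)) (moves s))
sumℚ-moves-∷ φ t s = begin
  sumℚ (map φ (map (_∷ s) (removals t) ++ map (t ∷_) (moves s)))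
    ≡⟨ cong sumℚ (map-++ φ (map (_∷ s) (removals t)) (map (t ∷_) (moves s))) ⟩
  sumℚ (map φ (map (_∷ s) (removals t)) ++ map φ (map (t ∷_) (moves s)))
    ≡⟨ sumℚ-++ (map φ (map (_∷ s) (removals t))) (map φ (map (t ∷_) (moves s))) ⟩
  sumℚ (map φ (map (_∷ s) (removals t))) + sumℚ (map φ (map (t ∷_) (moves s)))
    ≡⟨ cong₂ (λ a b → sumℚ a + sumℚ b) (map-∘ (removals t)) (map-∘ (moves s)) ⟨
  sumℚ (map (λ u → φ (u ∷ s)) (removals t)) + sumℚ (map (λ m → φ (t ∷ m)) (moves s))
    ∎
  where open ≡-Reasoning

sumℚ-const-removals : ∀ c t → sumℚ (map (λ _ → c) (removals t)) ≡ fromℕ t * c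
sumℚ-const-removals c t = trans (sumℚ-map-const c (removals t)) (cong (λ n → fromℕ n * c) (length-removals t))

sumℚ-const-moves : ∀ c s → sumℚ (map (λ _ → c) (moves s)) ≡ fromℕ (tokens s) * c
sumℚ-const-moves c s = trans (sumℚ-map-const c (moves s)) (cong (λ n → fromℕ n * c) (length-moves s))

avg-moves : ∀ (φ : Position → ℚ) {v} s {m ms} → moves s ≡ m ∷ ms →
            sumℚ (map φ (moves s)) ≡ fromℕ (tokens s) * v → avg (map φ (m ∷ ms)) ≡ v
avg-moves φ {v} s {m} {ms} eq sum≡ =
  avg-∷ (φ m) (map φ ms) (subst P eq (trans sum≡ (cong (λ n → fromℕ n * v) tokens≡length)))
  where
  P : List Position → Set
  P xs = sumℚ (map φ xs) ≡ fromℕ (length (map φ xs)) * v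
  tokens≡length : tokens s ≡ length (map φ (moves s))
  tokens≡length = trans (sym (length-moves s)) (sym (length-map φ (moves s)))

expMovesF-solution : (F : Position → ℚ) →
  (∀ s → tokens s ≡ 0 → F s ≡ 0ℚ) →
  (∀ s → sumℚ (map F (moves s)) ≡ fromℕ (tokens s) * (F s - 1ℚ)) →
  ∀ f s → tokens s ≤ f → expMovesF f s ≡ F s
expMovesF-solution F F-end F-moves zero s tokens≤0 = sym (F-end s (n≤0⇒n≡0 tokens≤0))
expMovesF-solution F F-end F-moves (suc f) s tokens≤ with moves s in eq
... | []     = sym (F-end s (moves≡[]⇒tokens≡0 s eq))
... | m ∷ ms = begin
  1ℚ + avg (map (expMovesF f) (m ∷ ms))  ≡⟨ cong (λ xs → 1ℚ + avg xs) (map-cong-local (All.tabulate fuel-suffices)) ⟩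
  1ℚ + avg (map F (m ∷ ms))              ≡⟨ cong (λ a → 1ℚ + a) (avg-moves F s eq (F-moves s)) ⟩
  1ℚ + (F s - 1ℚ)                        ≡⟨ 1+[x-1]≡x (F s) ⟩
  F s                                    ∎
  where
  open ≡-Reasoning
  fuel-suffices : ∀ {x} → x ∈ m ∷ ms → expMovesF f x ≡ F x
  fuel-suffices x∈ = expMovesF-solution F F-end F-moves f _ (moves-within-fuel s eq tokens≤ x∈)
  1+[x-1]≡x : ∀ x → 1ℚ + (x - 1ℚ) ≡ x
  1+[x-1]≡x = solve-∀ ℚ-ring

winProbF-solution : ∀ c (W : Position → ℚ) →
  (∀ s → tokens s ≡ 0 → W s ≡ terminalWin c) →
  (∀ s → sumℚ (map (λ m → 1ℚ - W m) (moves s)) ≡ fromℕ (tokens s) * W s) →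
  ∀ f s → tokens s ≤ f → winProbF c f s ≡ W s
winProbF-solution c W W-end W-moves zero s tokens≤0 = sym (W-end s (n≤0⇒n≡0 tokens≤0))
winProbF-solution c W W-end W-moves (suc f) s tokens≤ with moves s in eq
... | []     = sym (W-end s (moves≡[]⇒tokens≡0 s eq))
... | m ∷ ms = begin
  avg (map (λ s′ → 1ℚ - winProbF c f s′) (m ∷ ms))  ≡⟨ cong avg (map-cong-local (All.tabulate fuel-suffices)) ⟩
  avg (map (λ s′ → 1ℚ - W s′) (m ∷ ms))             ≡⟨ avg-moves (λ s′ → 1ℚ - W s′) s eq (W-moves s) ⟩
  W s                                               ∎
  where
  open ≡-Reasoning
  fuel-suffices : ∀ {x} → x ∈ m ∷ ms → 1ℚ - winProbF c f x ≡ 1ℚ - W x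
  fuel-suffices x∈ = cong (1ℚ -_) (winProbF-solution c W W-end W-moves f _ (moves-within-fuel s eq tokens≤ x∈))

ΣH : Position → ℚ
ΣH s = sumℚ (map H s)

ΣH-tokens≡0 : ∀ s → tokens s ≡ 0 → ΣH s ≡ 0ℚ
ΣH-tokens≡0 []          _        = refl
ΣH-tokens≡0 (zero ∷ s)  tokens≡0 = trans (+-identityˡ (ΣH s)) (ΣH-tokens≡0 s tokens≡0)
ΣH-tokens≡0 (suc _ ∷ _) ()

sumℚ-H-removals : ∀ t → sumℚ (map H (removals t)) ≡ fromℕ t * (H t - 1ℚ)
sumℚ-H-removals zero    = refl
sumℚ-H-removals (suc t) = begin
  H t + sumℚ (map H (removals t))       ≡⟨ cong (λ x → H t + x) (sumℚ-H-removals t) ⟩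
  H t + fromℕ t * (H t - 1ℚ)            ≡⟨ regroup (H t) (fromℕ t) ⟩
  (1ℚ + fromℕ t) * (H t - 1ℚ) + 1ℚ      ≡⟨ cong₂ (λ a b → a * (H t - 1ℚ) + b) (fromℕ-suc t) (fromℕ-suc-*-inverse t) ⟨
  N * (H t - 1ℚ) + N * r                ≡⟨ factor N (H t) r ⟩
  N * (H t + r - 1ℚ)                    ∎
  where
  open ≡-Reasoning
  N = fromℕ (suc t)
  r = + 1 / suc t
  regroup : ∀ h n → h + n * (h - 1ℚ) ≡ (1ℚ + n) * (h - 1ℚ) + 1ℚ
  regroup = solve-∀ ℚ-ring
  factor : ∀ n h r → n * (h - 1ℚ) + n * r ≡ n * (h + r - 1ℚ)
  factor = solve-∀ ℚ-ring

sumℚ-ΣH-moves : ∀ s → sumℚ (map ΣH (moves s)) ≡ fromℕ (tokens s) * (ΣH s - 1ℚ)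
sumℚ-ΣH-moves []      = refl
sumℚ-ΣH-moves (t ∷ s) = begin
  sumℚ (map ΣH (moves (t ∷ s)))
    ≡⟨ sumℚ-moves-∷ ΣH t s ⟩
  sumℚ (map (λ u → H u + e) (removals t)) + sumℚ (map (λ m → h + ΣH m) (moves s))
    ≡⟨ cong₂ _+_ (sumℚ-map-+ H (λ _ → e) (removals t)) (sumℚ-map-+ (λ _ → h) ΣH (moves s)) ⟩
  (sumℚ (map H (removals t)) + sumℚ (map (λ _ → e) (removals t))) + (sumℚ (map (λ _ → h) (moves s)) + sumℚ (map ΣH (moves s)))
    ≡⟨ cong₂ _+_ (cong₂ _+_ (sumℚ-H-removals t) (sumℚ-const-removals e t)) (cong₂ _+_ (sumℚ-const-moves h s) (sumℚ-ΣH-moves s)) ⟩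
  (n * (h - 1ℚ) + n * e) + (T * h + T * (e - 1ℚ))
    ≡⟨ collect n T h e ⟩
  (n + T) * (h + e - 1ℚ)
    ≡⟨ cong (_* (h + e - 1ℚ)) (fromℕ-+ t (tokens s)) ⟨
  fromℕ (t ℕ.+ tokens s) * (h + e - 1ℚ)
    ∎
  where
  open ≡-Reasoning
  h = H t
  e = ΣH s
  n = fromℕ t
  T = fromℕ (tokens s)
  collect : ∀ n T h e → (n * (h - 1ℚ) + n * e) + (T * h + T * (e - 1ℚ)) ≡ (n + T) * (h + e - 1ℚ)
  collect = solve-∀ ℚ-ring

expectedMoves≡ΣH : ∀ s → expectedMoves s ≡ ΣH s
expectedMoves≡ΣH s = expMovesF-solution ΣH ΣH-tokens≡0 sumℚ-ΣH-moves (tokens s) s ≤-refl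

-- big: some pile has at least two tokens; small p: every pile has at most one
-- token, and p is the parity of the number of 1-piles.
data Class : Set where
  big   : Class
  small : Bool → Class

infixr 5 _⊕_
_⊕_ : Class → Class → Class
big     ⊕ _       = big
small p ⊕ big     = big
small p ⊕ small q = small (p xor q)

⊕-identityˡ : ∀ x → small false ⊕ x ≡ x
⊕-identityˡ big       = refl
⊕-identityˡ (small q) = refl

⊕-zeroʳ : ∀ x → x ⊕ big ≡ big
⊕-zeroʳ big       = refl
⊕-zeroʳ (small p) = refl

⊕-assoc : ∀ x y z → (x ⊕ y) ⊕ z ≡ x ⊕ (y ⊕ z)
⊕-assoc big       y         z         = refl
⊕-assoc (small p) big       z         = refl
⊕-assoc (small p) (small q) big       = refl
⊕-assoc (small p) (small q) (small r) = cong small (xor-assoc p q r)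

⊕-comm : ∀ x y → x ⊕ y ≡ y ⊕ x
⊕-comm big       y         = sym (⊕-zeroʳ y)
⊕-comm (small p) big       = refl
⊕-comm (small p) (small q) = cong small (xor-comm p q)

⊕-swap : ∀ x y z → x ⊕ (y ⊕ z) ≡ y ⊕ (x ⊕ z)
⊕-swap x y z = begin
  x ⊕ (y ⊕ z)  ≡⟨ ⊕-assoc x y z ⟨
  (x ⊕ y) ⊕ z  ≡⟨ cong (_⊕ z) (⊕-comm x y) ⟩
  (y ⊕ x) ⊕ z  ≡⟨ ⊕-assoc y x z ⟩
  y ⊕ (x ⊕ z)  ∎
  where open ≡-Reasoning

pileClass : ℕ → Class
pileClass 0             = small false
pileClass 1             = small true
pileClass (suc (suc _)) = big

classOf : Position → Class
classOf []      = small false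
classOf (t ∷ s) = pileClass t ⊕ classOf s

winProb : Convention → Class → ℚ
winProb _      big       = + 1 / 2
winProb normal (small p) = if p then 1ℚ else 0ℚ
winProb misere (small p) = if not p then 1ℚ else 0ℚ

winProb-flip : ∀ c k → 1ℚ - winProb c k ≡ winProb c (small true ⊕ k)
winProb-flip _      big           = refl
winProb-flip normal (small true)  = refl
winProb-flip normal (small false) = refl
winProb-flip misere (small true)  = refl
winProb-flip misere (small false) = refl

sumℚ-winProb-removals : ∀ c t k →
  sumℚ (map (λ u → 1ℚ - winProb c (pileClass u ⊕ k)) (removals t)) ≡ fromℕ t * winProb c (pileClass t ⊕ k)
sumℚ-winProb-removals c 0 k = sym (*-zeroˡ (winProb c (small false ⊕ k)))
sumℚ-winProb-removals c 1 k = begin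
  (1ℚ - winProb c (small false ⊕ k)) + 0ℚ  ≡⟨ +-identityʳ _ ⟩
  1ℚ - winProb c (small false ⊕ k)         ≡⟨ cong (λ x → 1ℚ - winProb c x) (⊕-identityˡ k) ⟩
  1ℚ - winProb c k                         ≡⟨ winProb-flip c k ⟩
  winProb c (small true ⊕ k)               ≡⟨ *-identityˡ _ ⟨
  1ℚ * winProb c (small true ⊕ k)          ∎
  where open ≡-Reasoning
sumℚ-winProb-removals c 2 k = begin
  (1ℚ - a) + sumℚ (map (λ u → 1ℚ - winProb c (pileClass u ⊕ k)) (removals 1))
    ≡⟨ cong (λ x → (1ℚ - a) + x) (sumℚ-winProb-removals c 1 k) ⟩
  (1ℚ - a) + 1ℚ * a
    ≡⟨ complement a ⟩
  1ℚ
    ∎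
  where
  open ≡-Reasoning
  a = winProb c (small true ⊕ k)
  complement : ∀ a → (1ℚ - a) + 1ℚ * a ≡ 1ℚ
  complement = solve-∀ ℚ-ring
sumℚ-winProb-removals c (suc (suc (suc t))) k = begin
  ½ + sumℚ (map (λ u → 1ℚ - winProb c (pileClass u ⊕ k)) (removals (suc (suc t))))
    ≡⟨ cong (λ x → ½ + x) (sumℚ-winProb-removals c (suc (suc t)) k) ⟩
  ½ + fromℕ (suc (suc t)) * ½
    ≡⟨ fromℕ-suc-* (suc (suc t)) ½ ⟨
  fromℕ (suc (suc (suc t))) * ½
    ∎
  where
  open ≡-Reasoning
  ½ = + 1 / 2

sumℚ-winProb-moves : ∀ c s k →
  sumℚ (map (λ m → 1ℚ - winProb c (k ⊕ classOf m)) (moves s)) ≡ fromℕ (tokens s) * winProb c (k ⊕ classOf s)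
sumℚ-winProb-moves c []      k = sym (*-zeroˡ (winProb c (k ⊕ small false)))
sumℚ-winProb-moves c (t ∷ s) k = begin
  sumℚ (map (λ m → w (k ⊕ classOf m)) (moves (t ∷ s)))
    ≡⟨ sumℚ-moves-∷ (λ m → w (k ⊕ classOf m)) t s ⟩
  sumℚ (map (λ u → w (k ⊕ pileClass u ⊕ classOf s)) (removals t)) +
  sumℚ (map (λ m → w (k ⊕ pileClass t ⊕ classOf m)) (moves s))
    ≡⟨ cong₂ _+_ (cong sumℚ (map-cong (λ u → cong w (⊕-swap k (pileClass u) (classOf s))) (removals t)))
                 (cong sumℚ (map-cong (λ m → cong w (sym (⊕-assoc k (pileClass t) (classOf m)))) (moves s))) ⟩
  sumℚ (map (λ u → w (pileClass u ⊕ k ⊕ classOf s)) (removals t)) +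
  sumℚ (map (λ m → w ((k ⊕ pileClass t) ⊕ classOf m)) (moves s))
    ≡⟨ cong₂ _+_ (sumℚ-winProb-removals c t (k ⊕ classOf s)) (sumℚ-winProb-moves c s (k ⊕ pileClass t)) ⟩
  fromℕ t * winProb c (pileClass t ⊕ k ⊕ classOf s) + fromℕ (tokens s) * winProb c ((k ⊕ pileClass t) ⊕ classOf s)
    ≡⟨ cong₂ (λ x y → fromℕ t * winProb c x + fromℕ (tokens s) * winProb c y)
             (⊕-swap k (pileClass t) (classOf s)) (sym (⊕-assoc k (pileClass t) (classOf s))) ⟨
  fromℕ t * v + fromℕ (tokens s) * v
    ≡⟨ *-distribʳ-+ v (fromℕ t) (fromℕ (tokens s)) ⟨
  (fromℕ t + fromℕ (tokens s)) * v
    ≡⟨ cong (_* v) (fromℕ-+ t (tokens s)) ⟨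
  fromℕ (t ℕ.+ tokens s) * v
    ∎
  where
  open ≡-Reasoning
  w : Class → ℚ
  w x = 1ℚ - winProb c x
  v = winProb c (k ⊕ classOf (t ∷ s))

classOf-tokens≡0 : ∀ s → tokens s ≡ 0 → classOf s ≡ small false
classOf-tokens≡0 []          _        = refl
classOf-tokens≡0 (zero ∷ s)  tokens≡0 = trans (⊕-identityˡ (classOf s)) (classOf-tokens≡0 s tokens≡0)
classOf-tokens≡0 (suc _ ∷ _) ()

winProb-terminal : ∀ c → winProb c (small false) ≡ terminalWin c
winProb-terminal normal = refl
winProb-terminal misere = refl

firstPlayerWins≡winProb : ∀ c s → firstPlayerWins c s ≡ winProb c (classOf s)
firstPlayerWins≡winProb c s = winProbF-solution c (winProb c ∘ classOf) terminal sum-moves (tokens s) s ≤-refl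
  where
  terminal : ∀ s → tokens s ≡ 0 → winProb c (classOf s) ≡ terminalWin c
  terminal s tokens≡0 = trans (cong (winProb c) (classOf-tokens≡0 s tokens≡0)) (winProb-terminal c)
  sum-moves : ∀ s → sumℚ (map (λ m → 1ℚ - winProb c (classOf m)) (moves s)) ≡ fromℕ (tokens s) * winProb c (classOf s)
  sum-moves s = begin
    sumℚ (map (λ m → 1ℚ - winProb c (classOf m)) (moves s))
      ≡⟨ cong sumℚ (map-cong (λ m → cong (λ x → 1ℚ - winProb c x) (⊕-identityˡ (classOf m))) (moves s)) ⟨
    sumℚ (map (λ m → 1ℚ - winProb c (small false ⊕ classOf m)) (moves s))
      ≡⟨ sumℚ-winProb-moves c s (small false) ⟩
    fromℕ (tokens s) * winProb c (small false ⊕ classOf s)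
      ≡⟨ cong (λ x → fromℕ (tokens s) * winProb c x) (⊕-identityˡ (classOf s)) ⟩
    fromℕ (tokens s) * winProb c (classOf s)
      ∎
    where open ≡-Reasoning

Play-length-≤1 : ∀ {s n} → All (_≤ 1) s → Play s n → n ≡ tokens s
Play-length-≤1 {s} ≤1s (done no-moves) = sym (moves≡[]⇒tokens≡0 s no-moves)
Play-length-≤1 {s} ≤1s (step m∈ play) with Move-≤1 (∈-moves⇒Move s m∈) ≤1s
... | ≤1m , tokens≡ = trans (cong suc (Play-length-≤1 ≤1m play)) (sym tokens≡)

tokens-ones : ∀ {s} → All (_≡ 1) s → tokens s ≡ length s
tokens-ones []           = refl
tokens-ones (refl ∷ ≡1s) = cong suc (tokens-ones ≡1s)

odd : ℕ → Bool
odd n = n % 2 ≡ᵇ 1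

odd-suc : ∀ n → odd (suc n) ≡ not (odd n)
odd-suc 0             = refl
odd-suc 1             = refl
odd-suc (suc (suc n)) = odd-suc n

even≡not-odd : ∀ n → (n % 2 ≡ᵇ 0) ≡ not (odd n)
even≡not-odd 0             = refl
even≡not-odd 1             = refl
even≡not-odd (suc (suc n)) = even≡not-odd n

classOf-ones : ∀ {s} → All (_≡ 1) s → classOf s ≡ small (odd (length s))
classOf-ones []                   = refl
classOf-ones {_ ∷ s} (refl ∷ ≡1s) =
  trans (cong (small true ⊕_) (classOf-ones ≡1s)) (cong small (sym (odd-suc (length s))))

classOf-big : ∀ {s} → Any (1 <_) s → classOf s ≡ big
classOf-big (here (s≤s (s≤s _))) = refl
classOf-big {t ∷ _} (there any)  = trans (cong (pileClass t ⊕_) (classOf-big any)) (⊕-zeroʳ (pileClass t))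

Play-length-ones : ∀ {s} → All (_≡ 1) s → ∀ {n} → Play s n → n ≡ length s
Play-length-ones ≡1s play = trans (Play-length-≤1 (All.map (λ { refl → ≤-refl }) ≡1s) play) (tokens-ones ≡1s)

firstPlayerWins-ones : ∀ c {s} → All (_≡ 1) s → firstPlayerWins c s ≡ winProb c (small (odd (length s)))
firstPlayerWins-ones c {s} ≡1s = trans (firstPlayerWins≡winProb c s) (cong (winProb c) (classOf-ones ≡1s))

firstPlayerWins-big : ∀ c {s} → Any (1 <_) s → firstPlayerWins c s ≡ + 1 / 2
firstPlayerWins-big c {s} >1 = trans (firstPlayerWins≡winProb c s) (cong (winProb c) (classOf-big >1))

theorem5 : (s : List ℕ) → 1 ≤ length s → All (1 ≤_) s →
    (expectedMoves s ≡ sumℚ (map H s))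
    × (All (_≡ 1) s →
        (∀ {n} → Play s n → n ≡ length s)
        × (firstPlayerWins normal s ≡ (if length s % 2 ≡ᵇ 1 then 1ℚ else 0ℚ))
        × (firstPlayerWins misere s ≡ (if length s % 2 ≡ᵇ 0 then 1ℚ else 0ℚ)))
    × (Any (1 <_) s →
        (firstPlayerWins normal s ≡ + 1 / 2) × (firstPlayerWins misere s ≡ + 1 / 2))
theorem5 s _ _ =
  expectedMoves≡ΣH s ,
  (λ ≡1s → Play-length-ones ≡1s ,
           firstPlayerWins-ones normal ≡1s ,
           trans (firstPlayerWins-ones misere ≡1s) (cong (λ b → if b then 1ℚ else 0ℚ) (sym (even≡not-odd (length s))))) ,
  (λ >1 → firstPlayerWins-big normal >1 , firstPlayerWins-big misere >1)
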